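{- For positive integers $n$ and $r$, \[\alpha(H_{n:r})\ge \sum_{i=r+1}^{n}\binom{i-1}{r}=\binom{n}{r+1}.\]
   Context: For positive integers $n,r$ write $[n]=\{1,\dots,n\}$. The Häggkvist–Hell graph $H_{n:r}$ is the graph whose vertices are the ordered pairs $(h,T)$ where $T$ is an $r$-element subset of $[n]$ and $h\in[n]\setminus T$; two vertices $(h_x,T_x)$ and $(h_y,T_y)$ are adjacent iff $h_x\in T_y$, $h_y\in T_x$ and $T_x\cap T_y=\varnothing$. $\alpha$ denotes the independence number. -}

module Defs where

open import Data.Nat using (ℕ; suc; _+_; _∸_)
open import Data.Fin using (Fin)
open import Data.Fin.Subset using (Subset; _∈_; _∉_; ∣_∣; _∩_; Empty)
open import Data.List using (List; map; upTo; length)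
open import Data.Nat.ListAction using (sum)
open import Data.List.Relation.Unary.All using (All)
open import Data.List.Relation.Unary.AllPairs using (AllPairs)
open import Data.Product using (_×_; _,_; Σ; proj₁; proj₂)
open import Relation.Binary.PropositionalEquality using (_≡_; _≢_)
open import Relation.Nullary using (¬_)

-- Ground set [n] is modelled by Fin n (elements 0..n-1).
-- A candidate vertex of H_{n:r} is a pair (h , T).
Pair : ℕ → Set
Pair n = Fin n × Subset n

IsVertex : (n r : ℕ) → Pair n → Set
IsVertex n r (h , T) = (∣ T ∣ ≡ r) × (h ∉ T)

Adj : {n : ℕ} → Pair n → Pair n → Set
Adj (hx , Tx) (hy , Ty) = (hx ∈ Ty) × (hy ∈ Tx) × Empty (Tx ∩ Ty)

IsIndependent : (n r : ℕ) → List (Pair n) → Set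
IsIndependent n r xs =
  All (IsVertex n r) xs × AllPairs (λ x y → x ≢ y) xs × AllPairs (λ x y → ¬ Adj x y) xs

αAtLeast : (n r k : ℕ) → Set
αAtLeast n r k = Σ (List (Pair n)) (λ xs → IsIndependent n r xs × (length xs ≡ k))

-- ∑_{i=a}^{b} f i  (empty when b < a).
sumRange : ℕ → ℕ → (ℕ → ℕ) → ℕ
sumRange a b f = sum (map (λ k → f (a + k)) (upTo (suc b ∸ a)))

module Submission where

-- Call a vertex (h , T) of H_{n:r} *anchored* when h lies below
-- every element of T.  Two anchored vertices x, y are never adjacent: adjacency
-- would give h_x ∈ T_y and h_y ∈ T_x, hence h_y < h_x < h_y.  Anchored vertices
-- correspond bijectively to (r+1)-subsets of [n] (split off the minimum), so
-- they form an independent set of size C(n, r+1).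
--
-- Finally the hockey-stick identity ∑_{i=r+1}^{n} C(i-1, r) = C(n, r+1)
-- identifies the size with the sum in the statement.

open import Defs
open import Data.Nat using (ℕ; suc; _∸_; _≤_; _<_)
open import Data.Nat.Combinatorics using (_C_)
open import Data.Product using (_×_)
open import Relation.Binary.PropositionalEquality using (_≡_)

open import Data.Nat using (zero; _+_; s≤s; z≤n)
open import Data.Nat.Properties using (+-comm; +-suc; +-identityʳ; <-asym; ≤-reflexive; ≤-total; m≤n⇒m∸n≡0; m+n∸m≡n; m≤n⇒∃[o]m+o≡n)
open import Data.Nat.Combinatorics using (nCk+nC[k+1]≡[n+1]C[k+1]; k>n⇒nCk≡0)
open import Data.Nat.ListAction using (sum)
open import Data.Nat.ListAction.Properties using (sum-++)
import Data.Fin as Fin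
open import Data.Fin.Subset using (Subset; _∈_; ∣_∣; ⊥; inside; outside)
open import Data.Fin.Subset.Properties using (∣⊥∣≡0)
open import Data.Vec using (_∷_; there)
open import Data.Vec.Properties using (∷-injectiveˡ; ∷-injectiveʳ)
open import Data.List using (List; []; _∷_; [_]; map; _++_; length; applyUpTo; upTo)
open import Data.List.Properties using (length-++; length-map; map-upTo; applyUpTo-∷ʳ)
open import Data.List.Membership.Propositional.Properties using (∈-map⁻)
open import Data.List.Relation.Unary.All as All using (All; []; _∷_)
open import Data.List.Relation.Unary.All.Properties using (++⁺; map⁺)
open import Data.List.Relation.Unary.AllPairs using (AllPairs; []; _∷_)
open import Data.List.Relation.Unary.Unique.Propositional using (Unique)
import Data.List.Relation.Unary.Unique.Propositional.Properties as Unique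
open import Data.List.Relation.Binary.Disjoint.Propositional using (Disjoint)
open import Data.Product using (_,_; proj₁; proj₂)
open import Data.Sum using (inj₁; inj₂)
open import Relation.Nullary using (¬_)
open import Relation.Binary.PropositionalEquality using (refl; sym; trans; cong; cong₂; _≢_; module ≡-Reasoning)

open ≡-Reasoning

map-disjoint : ∀ {A B C : Set} {f : A → C} {g : B → C} →
  (∀ x y → f x ≢ g y) → (xs : List A) (ys : List B) → Disjoint (map f xs) (map g ys)
map-disjoint {f = f} {g} f≢g xs ys (v∈fxs , v∈gys)
  with ∈-map⁻ f v∈fxs | ∈-map⁻ g v∈gys
... | x , _ , v≡fx | y , _ , v≡gy = f≢g x y (trans (sym v≡fx) v≡gy)

allPairs-from-All : ∀ {A : Set} {P : A → Set} {R : A → A → Set} →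
  (∀ {x y} → P x → P y → R x y) → ∀ {xs} → All P xs → AllPairs R xs
allPairs-from-All related []         = []
allPairs-from-All related (px ∷ pxs) = All.map (related px) pxs ∷ allPairs-from-All related pxs

subsets : (n r : ℕ) → List (Subset n)
subsets n       zero    = [ ⊥ ]
subsets zero    (suc r) = []
subsets (suc n) (suc r) = map (outside ∷_) (subsets n (suc r)) ++ map (inside ∷_) (subsets n r)

subsets-size : ∀ n r → All (λ T → ∣ T ∣ ≡ r) (subsets n r)
subsets-size n       zero    = ∣⊥∣≡0 n ∷ []
subsets-size zero    (suc r) = []
subsets-size (suc n) (suc r) =
  ++⁺ (map⁺ (subsets-size n (suc r))) (map⁺ (All.map (cong suc) (subsets-size n r)))

subsets-unique : ∀ n r → Unique (subsets n r)
subsets-unique n       zero    = [] ∷ []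
subsets-unique zero    (suc r) = []
subsets-unique (suc n) (suc r) =
  Unique.++⁺ (Unique.map⁺ ∷-injectiveʳ (subsets-unique n (suc r)))
             (Unique.map⁺ ∷-injectiveʳ (subsets-unique n r))
             (map-disjoint (λ _ _ eq → outside≢inside (∷-injectiveˡ eq)) (subsets n (suc r)) (subsets n r))
  where
  outside≢inside : outside ≢ inside
  outside≢inside ()

length-subsets : ∀ n r → length (subsets n r) ≡ n C r
length-subsets n       zero    = refl
length-subsets zero    (suc r) = refl
length-subsets (suc n) (suc r) = begin
  length (map (outside ∷_) (subsets n (suc r)) ++ map (inside ∷_) (subsets n r))
    ≡⟨ length-++ (map (outside ∷_) (subsets n (suc r))) ⟩
  length (map (outside ∷_) (subsets n (suc r))) + length (map (inside ∷_) (subsets n r))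
    ≡⟨ cong₂ _+_ (trans (length-map _ (subsets n (suc r))) (length-subsets n (suc r)))
               (trans (length-map _ (subsets n r)) (length-subsets n r)) ⟩
  n C suc r + n C r
    ≡⟨ +-comm (n C suc r) (n C r) ⟩
  n C r + n C suc r
    ≡⟨ nCk+nC[k+1]≡[n+1]C[k+1] n r ⟩
  suc n C suc r ∎

Anchored : ∀ {n} → Pair n → Set
Anchored (h , T) = ∀ j → j ∈ T → h Fin.< j

-- Key observation: anchored vertices are never adjacent, since adjacency
-- would force each anchor to lie strictly below the other.
anchored-nonAdjacent : ∀ {n} {x y : Pair n} → Anchored x → Anchored y → ¬ Adj x y
anchored-nonAdjacent {x = hx , _} {hy , _} x-anch y-anch (hx∈Ty , hy∈Tx , _) =
  <-asym (x-anch hy hy∈Tx) (y-anch hx hx∈Ty)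

anchored-independent : ∀ n r (xs : List (Pair n)) →
  All (λ x → IsVertex n r x × Anchored x) xs → Unique xs → IsIndependent n r xs
anchored-independent n r xs good unique =
  All.map proj₁ good , unique ,
  allPairs-from-All (λ gx gy → anchored-nonAdjacent (proj₂ gx) (proj₂ gy)) good

anchorAtZero : ∀ {n} → Subset n → Pair (suc n)
anchorAtZero T = Fin.zero , outside ∷ T

shift : ∀ {n} → Pair n → Pair (suc n)
shift (h , T) = Fin.suc h , outside ∷ T

anchoredVertices : (n r : ℕ) → List (Pair n)
anchoredVertices zero    r = []
anchoredVertices (suc n) r = map anchorAtZero (subsets n r) ++ map shift (anchoredVertices n r)

anchoredVertices-good : ∀ n r → All (λ x → IsVertex n r x × Anchored x) (anchoredVertices n r)
anchoredVertices-good zero    r = []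
anchoredVertices-good (suc n) r =
  ++⁺ (map⁺ (All.map anchorAtZero-good (subsets-size n r)))
      (map⁺ (All.map shift-good (anchoredVertices-good n r)))
  where
  anchorAtZero-good : ∀ {T} → ∣ T ∣ ≡ r → IsVertex (suc n) r (anchorAtZero T) × Anchored (anchorAtZero T)
  anchorAtZero-good size = (size , λ ()) , λ { (Fin.suc j) _ → s≤s z≤n }
  shift-good : ∀ {x} → IsVertex n r x × Anchored x → IsVertex (suc n) r (shift x) × Anchored (shift x)
  shift-good ((size , h∉T) , anchored) =
    (size , λ { (there h∈T) → h∉T h∈T }) , λ { (Fin.suc j) (there j∈T) → s≤s (anchored j j∈T) }

anchoredVertices-unique : ∀ n r → Unique (anchoredVertices n r)
anchoredVertices-unique zero    r = []
anchoredVertices-unique (suc n) r =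
  Unique.++⁺ (Unique.map⁺ anchorAtZero-injective (subsets-unique n r))
             (Unique.map⁺ shift-injective (anchoredVertices-unique n r))
             (map-disjoint (λ { _ _ () }) (subsets n r) (anchoredVertices n r))
  where
  anchorAtZero-injective : ∀ {T U : Subset n} → anchorAtZero T ≡ anchorAtZero U → T ≡ U
  anchorAtZero-injective refl = refl
  shift-injective : ∀ {x y : Pair n} → shift x ≡ shift y → x ≡ y
  shift-injective {_ , _} refl = refl

length-anchoredVertices : ∀ n r → length (anchoredVertices n r) ≡ n C suc r
length-anchoredVertices zero    r = refl
length-anchoredVertices (suc n) r = begin
  length (map anchorAtZero (subsets n r) ++ map shift (anchoredVertices n r))
    ≡⟨ length-++ (map anchorAtZero (subsets n r)) ⟩
  length (map anchorAtZero (subsets n r)) + length (map shift (anchoredVertices n r))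
    ≡⟨ cong₂ _+_ (trans (length-map anchorAtZero (subsets n r)) (length-subsets n r))
                 (trans (length-map shift (anchoredVertices n r)) (length-anchoredVertices n r)) ⟩
  n C r + n C suc r
    ≡⟨ nCk+nC[k+1]≡[n+1]C[k+1] n r ⟩
  suc n C suc r ∎

hockeyStick : ∀ r m → sum (applyUpTo (λ k → (r + k) C r) m) ≡ (r + m) C suc r
hockeyStick r zero    = sym (k>n⇒nCk≡0 {r + 0} {suc r} (s≤s (≤-reflexive (+-identityʳ r))))
hockeyStick r (suc m) = begin
  sum (applyUpTo f (suc m))        ≡⟨ cong sum (sym (applyUpTo-∷ʳ f m)) ⟩
  sum (applyUpTo f m ++ [ f m ])   ≡⟨ sum-++ (applyUpTo f m) [ f m ] ⟩
  sum (applyUpTo f m) + (f m + 0)  ≡⟨ cong₂ _+_ (hockeyStick r m) (+-identityʳ (f m)) ⟩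
  (r + m) C suc r + (r + m) C r    ≡⟨ +-comm ((r + m) C suc r) ((r + m) C r) ⟩
  (r + m) C r + (r + m) C suc r    ≡⟨ nCk+nC[k+1]≡[n+1]C[k+1] (r + m) r ⟩
  suc (r + m) C suc r              ≡⟨ cong (_C suc r) (sym (+-suc r m)) ⟩
  (r + suc m) C suc r              ∎
  where
  f : ℕ → ℕ
  f k = (r + k) C r

-- The sum in the statement equals C(n, r+1): it is empty when n ≤ r, and is a
-- hockey-stick sum with m = n - r terms otherwise.
sum-binomials : ∀ n r → sumRange (suc r) n (λ i → (i ∸ 1) C r) ≡ n C suc r
sum-binomials n r with ≤-total n r
... | inj₁ n≤r = begin
  sum (map (λ k → (r + k) C r) (upTo (n ∸ r)))  ≡⟨ cong (λ m → sum (map (λ k → (r + k) C r) (upTo m))) (m≤n⇒m∸n≡0 n≤r) ⟩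
  0                                             ≡⟨ sym (k>n⇒nCk≡0 (s≤s n≤r)) ⟩
  n C suc r                                     ∎
... | inj₂ r≤n with m≤n⇒∃[o]m+o≡n r≤n
... | m , refl = begin
  sum (map (λ k → (r + k) C r) (upTo (r + m ∸ r)))  ≡⟨ cong (λ l → sum (map (λ k → (r + k) C r) (upTo l))) (m+n∸m≡n r m) ⟩
  sum (map (λ k → (r + k) C r) (upTo m))            ≡⟨ cong sum (map-upTo (λ k → (r + k) C r) m) ⟩
  sum (applyUpTo (λ k → (r + k) C r) m)             ≡⟨ hockeyStick r m ⟩
  (r + m) C suc r                                   ∎

mainTheorem11 : (n r : ℕ) → 0 < n → 0 < r →
    αAtLeast n r (sumRange (suc r) n (λ i → (i ∸ 1) C r))
      × (sumRange (suc r) n (λ i → (i ∸ 1) C r) ≡ n C (suc r))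
mainTheorem11 n r _ _ = (anchoredVertices n r , independent , size) , sum-binomials n r
  where
  independent : IsIndependent n r (anchoredVertices n r)
  independent = anchored-independent n r (anchoredVertices n r)
                  (anchoredVertices-good n r) (anchoredVertices-unique n r)
  size : length (anchoredVertices n r) ≡ sumRange (suc r) n (λ i → (i ∸ 1) C r)
  size = trans (length-anchoredVertices n r) (sym (sum-binomials n r))
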